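{- Let $G$ be a graph with an even number $n\geq 4$ of vertices. Then $\mathrm{mp}(G)=n-2$ if and only if $\delta(G)=n-2$.
   Context: All graphs are finite, simple and undirected; $\delta(G)$ is the minimum degree. A perfect matching is a set of edges covering every vertex exactly once; an almost-perfect matching is a set of edges covering every vertex except one exactly once and missing the remaining vertex. The matching preclusion number $\mathrm{mp}(G)$ is the minimum number of edges whose deletion leaves a graph with neither a perfect matching nor an almost-perfect matching ($\mathrm{mp}(G)=0$ if $G$ has neither). -}

module Defs where

open import Data.Nat using (ℕ; zero; suc; _+_; _≤_; _<ᵇ_)
open import Data.Bool using (Bool; true; false; _∧_; not)
open import Data.Fin using (Fin; toℕ)
open import Data.List using (List; []; _∷_; map; concatMap; allFin)
open import Data.Product using (Σ; _×_; ∃)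
open import Data.Sum using (_⊎_)
open import Relation.Nullary using (¬_)
open import Relation.Binary.PropositionalEquality using (_≡_)

record Graph (n : ℕ) : Set where
  field
    adj    : Fin n → Fin n → Bool
    sym    : ∀ i j → adj i j ≡ adj j i
    irrefl : ∀ i → adj i i ≡ false
open Graph public

countT : List Bool → ℕ
countT []           = 0
countT (true ∷ bs)  = suc (countT bs)
countT (false ∷ bs) = countT bs

deg : ∀ {n} → Graph n → Fin n → ℕ
deg {n} G v = countT (map (adj G v) (allFin n))

IsMinDegree : ∀ {n} → Graph n → ℕ → Set
IsMinDegree {n} G d = (∀ v → d ≤ deg G v) × ∃ λ v → deg G v ≡ d

_⊆G_ : ∀ {n} → Graph n → Graph n → Set
H ⊆G G = ∀ i j → adj H i j ≡ true → adj G i j ≡ true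

-- number of edges of G that are not edges of H (each unordered edge {i,j}
-- counted once, via i < j)
deleted : ∀ {n} → Graph n → Graph n → ℕ
deleted {n} G H =
  countT (concatMap (λ i → map (λ j → (toℕ i <ᵇ toℕ j) ∧ (adj G i j ∧ not (adj H i j)))
                              (allFin n))
                    (allFin n))

HasPerfectMatching : ∀ {n} → Graph n → Set
HasPerfectMatching {n} H = Σ (Graph n) λ M → M ⊆G H × (∀ v → deg M v ≡ 1)

HasAlmostPerfectMatching : ∀ {n} → Graph n → Set
HasAlmostPerfectMatching {n} H =
  Σ (Graph n) λ M → M ⊆G H × ∃ λ u → deg M u ≡ 0 × (∀ v → ¬ (v ≡ u) → deg M v ≡ 1)

Unmatchable : ∀ {n} → Graph n → Set
Unmatchable H = ¬ HasPerfectMatching H × ¬ HasAlmostPerfectMatching H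

-- mp(G) = k : k is the minimum number of edges whose deletion makes G
-- unmatchable (k = 0 if G is already unmatchable, by taking H = G)
IsMP : ∀ {n} → Graph n → ℕ → Set
IsMP {n} G k =
  (Σ (Graph n) λ H → H ⊆G G × Unmatchable H × deleted G H ≡ k)
  × (∀ (H : Graph n) → H ⊆G G → Unmatchable H → k ≤ deleted G H)

module Submission where

-- Write n = 2t + 2.  Isolating a vertex v (deleting its deg G v edges) leaves
-- no perfect matching, and by parity no graph on an even number of vertices
-- has an almost-perfect matching; hence mp(G) ≤ deg G v for every v.
-- Conversely, the complete graph K_n splits into n - 1 = 2t + 1 edge-disjoint
-- perfect matchings (the round-robin 1-factorisation, built from arithmetic
-- modulo the odd number 2t + 1).  Each deleted edge spoils at most one colour
-- class, so if the non-edges of G meet at most s classes, deleting fewer than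
-- 2t + 1 - s edges leaves a whole class, i.e. a perfect matching.
--  * δ(G) = n - 2 ⇒ mp(G) = n - 2: the complement of G is a matching, and
--    conjugating the factorisation by a suitable permutation puts it inside
--    colour class 0 (s = 1); isolating a vertex of degree n - 2 attains n - 2.
--  * mp(G) = n - 2 ⇒ δ(G) = n - 2: isolation gives δ(G) ≥ n - 2; if no vertex
--    had degree n - 2, G would be complete (s = 0) and no n - 2 deletions
--    could destroy every perfect matching.

open import Defs hiding (sym)

open import Data.Bool using (Bool; true; false; _∧_; not; if_then_else_)
open import Data.Bool.Properties using (T-≡; ∧-comm; ∧-zeroʳ) renaming (_≟_ to _≟B_)
open import Data.Empty using (⊥; ⊥-elim)
open import Data.Fin using (Fin; toℕ; fromℕ<; zero; suc) renaming (_≟_ to _≟F_)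
open import Data.Fin.Permutation using (Permutation′; _⟨$⟩ʳ_; _⟨$⟩ˡ_; inverseˡ; inverseʳ; _∘ₚ_; transpose)
  renaming (id to idₚ)
import Data.Fin.Permutation.Components as PC
open import Data.Fin.Properties using (toℕ-injective; toℕ<n; toℕ-fromℕ<; any?; pigeonhole; ¬∀⟶∃¬)
open import Data.List using (List; []; _∷_; map; concatMap; allFin; tabulate; _++_; length; lookup)
open import Data.List.Membership.Propositional using (_∈_; _∉_; lose)
open import Data.List.Membership.Propositional.Properties using (∈-concatMap⁺; ∈-allFin; ∈-++⁺ˡ; ∈-++⁺ʳ)
open import Data.List.Properties using (length-++)
open import Data.List.Relation.Unary.All using (All; []; _∷_)
open import Data.List.Relation.Unary.AllPairs using ([]; _∷_)
open import Data.List.Relation.Unary.Any using (here; index)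
open import Data.List.Relation.Unary.Any.Properties using (lookup-index)
open import Data.List.Relation.Unary.Unique.Propositional using (Unique)
open import Data.Nat
open import Data.Nat.DivMod
open import Data.Nat.Divisibility using (_∣_; divides)
open import Data.Nat.Properties
open import Algebra.Properties.CommutativeMonoid.Sum +-0-commutativeMonoid
  using (sum-syntax; sum-cong-≗; ∑-distrib-+; ∑-comm)
open import Data.Nat.Tactic.RingSolver using (solve-∀)
open import Data.Product using (Σ; ∃; _×_; _,_; proj₁; proj₂)
open import Data.Sum using (_⊎_; inj₁; inj₂)
open import Function using (_∘_)
open import Function.Bundles using (Equivalence)
open import Relation.Binary.Definitions using (tri<; tri≈; tri>)
open import Relation.Binary.PropositionalEquality
open import Relation.Nullary using (Dec; yes; no; does; ¬_)
open import Relation.Nullary.Decidable using (dec-true; dec-false; _×-dec_; _⊎-dec_; ¬?)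

𝟙 : Bool → ℕ
𝟙 b = if b then 1 else 0

δ : ∀ {n} → Fin n → Fin n → ℕ
δ i j = 𝟙 (does (i ≟F j))

∑-zero : ∀ n → ∑[ i < n ] 0 ≡ 0
∑-zero zero = refl
∑-zero (suc n) = ∑-zero n

∑-one : ∀ n → ∑[ i < n ] 1 ≡ n
∑-one zero = refl
∑-one (suc n) = cong suc (∑-one n)

∑-mono : ∀ n {f g : Fin n → ℕ} → (∀ i → f i ≤ g i) → ∑[ i < n ] f i ≤ ∑[ i < n ] g i
∑-mono zero f≤g = z≤n
∑-mono (suc n) f≤g = +-mono-≤ (f≤g zero) (∑-mono n (f≤g ∘ suc))

∑-δ : ∀ {n} (v : Fin n) (f : Fin n → ℕ) → ∑[ j < n ] (if does (j ≟F v) then f j else 0) ≡ f v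
∑-δ {suc n} zero f = trans (cong (f zero +_) (∑-zero n)) (+-identityʳ _)
∑-δ {suc n} (suc v) f = ∑-δ v (f ∘ suc)

countT-++ : ∀ xs ys → countT (xs ++ ys) ≡ countT xs + countT ys
countT-++ [] ys = refl
countT-++ (true ∷ xs) ys = cong suc (countT-++ xs ys)
countT-++ (false ∷ xs) ys = countT-++ xs ys

countT-tabulate : ∀ {A : Set} {n} (h : Fin n → A) (b : A → Bool) →
  countT (map b (tabulate h)) ≡ ∑[ i < n ] 𝟙 (b (h i))
countT-tabulate {n = zero} h b = refl
countT-tabulate {n = suc n} h b with b (h zero)
... | true = cong suc (countT-tabulate (h ∘ suc) b)
... | false = countT-tabulate (h ∘ suc) b

countT-concatMap : ∀ {A : Set} {n} (h : Fin n → A) (F : A → List Bool) →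
  countT (concatMap F (tabulate h)) ≡ ∑[ i < n ] countT (F (h i))
countT-concatMap {n = zero} h F = refl
countT-concatMap {n = suc n} h F =
  trans (countT-++ (F (h zero)) _) (cong (countT (F (h zero)) +_) (countT-concatMap (h ∘ suc) F))

<ᵇ-true : ∀ {a b} → a < b → (a <ᵇ b) ≡ true
<ᵇ-true a<b = Equivalence.to T-≡ (<⇒<ᵇ a<b)

<ᵇ-false : ∀ {a b} → b ≤ a → (a <ᵇ b) ≡ false
<ᵇ-false {a} {b} b≤a with a <ᵇ b | <ᵇ⇒< a b
... | false | _ = refl
... | true | a<b = ⊥-elim (<⇒≱ (a<b _) b≤a)

module _ {n : ℕ} where

  deg-sum : (G : Graph n) (v : Fin n) → deg G v ≡ ∑[ j < n ] 𝟙 (adj G v j)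
  deg-sum G v = countT-tabulate (λ j → j) (adj G v)

  edges : (Fin n → Fin n → Bool) → ℕ
  edges f = ∑[ i < n ] ∑[ j < n ] 𝟙 ((toℕ i <ᵇ toℕ j) ∧ f i j)

  lost : Graph n → Graph n → Fin n → Fin n → Bool
  lost G H i j = (toℕ i <ᵇ toℕ j) ∧ (adj G i j ∧ not (adj H i j))

  deleted-edges : (G H : Graph n) → deleted G H ≡ edges (λ i j → adj G i j ∧ not (adj H i j))
  deleted-edges G H =
    trans (countT-concatMap (λ i → i) (λ i → map (lost G H i) (allFin n)))
          (sum-cong-≗ (λ i → countT-tabulate (λ j → j) (lost G H i)))

  handshake : (f : Fin n → Fin n → Bool) → (∀ i j → f i j ≡ f j i) → (∀ i → f i i ≡ false) →
    ∑[ i < n ] ∑[ j < n ] 𝟙 (f i j) ≡ edges f + edges f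
  handshake f f-sym f-irr = begin
    ∑[ i < n ] ∑[ j < n ] 𝟙 (f i j)
      ≡⟨ sum-cong-≗ (λ i → trans (sum-cong-≗ (split i))
                                   (∑-distrib-+ (λ j → 𝟙 (below i j)) (λ j → 𝟙 (below j i)))) ⟩
    ∑[ i < n ] (∑[ j < n ] 𝟙 (below i j) + ∑[ j < n ] 𝟙 (below j i))
      ≡⟨ ∑-distrib-+ (λ i → ∑[ j < n ] 𝟙 (below i j)) (λ i → ∑[ j < n ] 𝟙 (below j i)) ⟩
    edges f + ∑[ i < n ] ∑[ j < n ] 𝟙 (below j i)
      ≡⟨ cong (edges f +_) (∑-comm (λ i j → 𝟙 (below j i))) ⟩
    edges f + edges f ∎
    where
    open ≡-Reasoning
    below : Fin n → Fin n → Bool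
    below i j = (toℕ i <ᵇ toℕ j) ∧ f i j
    split : ∀ i j → 𝟙 (f i j) ≡ 𝟙 (below i j) + 𝟙 (below j i)
    split i j with <-cmp (toℕ i) (toℕ j)
    ... | tri< i<j _ _ rewrite <ᵇ-true i<j | <ᵇ-false (<⇒≤ i<j) = sym (+-identityʳ _)
    ... | tri> _ _ j<i rewrite <ᵇ-true j<i | <ᵇ-false (<⇒≤ j<i) = cong 𝟙 (f-sym i j)
    ... | tri≈ _ i≡j _ rewrite toℕ-injective i≡j | f-irr j | <ᵇ-false (≤-refl {toℕ j}) = refl

  occ : List (Fin n) → Fin n → ℕ
  occ [] j = 0
  occ (w ∷ ws) j = δ j w + occ ws j

  ∑-occ : ∀ ws → ∑[ j < n ] occ ws j ≡ length ws
  ∑-occ [] = ∑-zero n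
  ∑-occ (w ∷ ws) =
    trans (∑-distrib-+ (λ j → δ j w) (occ ws)) (cong₂ _+_ (∑-δ w (λ _ → 1)) (∑-occ ws))

  occ-absent : ∀ {j} ws → All (j ≢_) ws → occ ws j ≡ 0
  occ-absent [] [] = refl
  occ-absent (w ∷ ws) (j≢w ∷ j∉ws) rewrite dec-false (_ ≟F w) j≢w = occ-absent ws j∉ws

  neighbour-or-listed : (G : Graph n) (v : Fin n) (ws : List (Fin n)) → Unique ws →
    All (λ w → adj G v w ≡ false) ws → ∀ j → 𝟙 (adj G v j) + occ ws j ≤ 1
  neighbour-or-listed G v [] _ _ j with adj G v j
  ... | true = ≤-refl
  ... | false = z≤n
  neighbour-or-listed G v (w ∷ ws) (w∉ws ∷ ws-unique) (v≁w ∷ v≁ws) j with j ≟F w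
  ... | yes refl rewrite v≁w | occ-absent ws w∉ws = ≤-refl
  ... | no _ = neighbour-or-listed G v ws ws-unique v≁ws j

  -- A vertex with k distinct non-neighbours (possibly including itself)
  -- has degree at most n - k.
  nonNeighbours-bound : (G : Graph n) (v : Fin n) (ws : List (Fin n)) → Unique ws →
    All (λ w → adj G v w ≡ false) ws → deg G v + length ws ≤ n
  nonNeighbours-bound G v ws ws-unique v≁ws =
    subst₂ _≤_ total (∑-one n) (∑-mono n (neighbour-or-listed G v ws ws-unique v≁ws))
    where
    total : ∑[ j < n ] (𝟙 (adj G v j) + occ ws j) ≡ deg G v + length ws
    total = trans (∑-distrib-+ (λ j → 𝟙 (adj G v j)) (occ ws))
                  (cong₂ _+_ (sym (deg-sum G v)) (∑-occ ws))

-- No graph with an even number of vertices has an almost-perfect matching: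
-- the degrees of such a matching add up to n - 1, which is odd, whereas by
-- the handshake lemma they add up to twice its number of edges.
no-almost-perfect : ∀ t (H : Graph (2 + 2 * t)) → ¬ HasAlmostPerfectMatching H
no-almost-perfect t H (M , _ , u , u-free , covered) =
  even≢odd (edges (adj M)) t (suc-injective (trans (+-comm 1 _) degree-total))
  where
  open ≡-Reasoning
  n : ℕ
  n = 2 + 2 * t
  e : ℕ
  e = edges (adj M)
  twice : 2 * e ≡ e + e
  twice = cong (e +_) (+-identityʳ e)
  covered-once : ∀ v → deg M v + δ v u ≡ 1
  covered-once v with v ≟F u
  ... | yes refl = cong (_+ 1) u-free
  ... | no v≢u = trans (+-identityʳ _) (covered v v≢u)
  degree-total : 2 * e + 1 ≡ n
  degree-total = begin
    2 * e + 1
      ≡⟨ cong₂ _+_ (trans twice (sym (handshake (adj M) (Graph.sym M) (irrefl M)))) (sym (∑-δ u (λ _ → 1))) ⟩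
    ∑[ v < n ] ∑[ j < n ] 𝟙 (adj M v j) + ∑[ v < n ] δ v u
      ≡⟨ cong (_+ ∑[ v < n ] δ v u) (sum-cong-≗ (λ v → sym (deg-sum M v))) ⟩
    ∑[ v < n ] deg M v + ∑[ v < n ] δ v u
      ≡⟨ sym (∑-distrib-+ (deg M) (λ v → δ v u)) ⟩
    ∑[ v < n ] (deg M v + δ v u)
      ≡⟨ sum-cong-≗ covered-once ⟩
    ∑[ v < n ] 1
      ≡⟨ ∑-one n ⟩
    n ∎

isolated⇒no-perfect : ∀ {n} (H : Graph n) (v : Fin n) → (∀ j → adj H v j ≡ false) →
  ¬ HasPerfectMatching H
isolated⇒no-perfect {n} H v v-isolated (M , M⊆H , perfect) =
  0≢1+n (trans (sym (trans (deg-sum M v) (trans (sum-cong-≗ unmatched) (∑-zero n)))) (perfect v))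
  where
  unmatched : ∀ j → 𝟙 (adj M v j) ≡ 0
  unmatched j with adj M v j in vj
  ... | false = refl
  ... | true with trans (sym (M⊆H v j vj)) (v-isolated j)
  ...   | ()

isolate : ∀ {n} → Graph n → Fin n → Graph n
isolate G v = record
  { adj = λ i j → adj G i j ∧ (not (does (i ≟F v)) ∧ not (does (j ≟F v)))
  ; sym = λ i j → cong₂ _∧_ (Graph.sym G i j) (∧-comm (not (does (i ≟F v))) (not (does (j ≟F v))))
  ; irrefl = λ i → cong (_∧ _) (irrefl G i)
  }

module _ {n : ℕ} (G : Graph n) (v : Fin n) where

  isolate-⊆ : isolate G v ⊆G G
  isolate-⊆ i j e with adj G i j
  ... | true = refl
  ... | false = e

  isolate-isolates : ∀ j → adj (isolate G v) v j ≡ false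
  isolate-isolates j rewrite dec-true (v ≟F v) refl = ∧-zeroʳ (adj G v j)

  removed : Fin n → Fin n → Bool
  removed i j = adj G i j ∧ not (adj (isolate G v) i j)

  at-v : Fin n → ℕ → ℕ
  at-v i x = if does (i ≟F v) then x else 0

  removed-at-v : ∀ i j → 𝟙 (removed i j) ≡ at-v i (𝟙 (adj G i j)) + at-v j (𝟙 (adj G i j))
  removed-at-v i j with i ≟F v | j ≟F v | adj G i j in ij
  ... | yes refl | yes refl | false = refl
  ... | yes _ | no _ | true = refl
  ... | yes _ | no _ | false = refl
  ... | no _ | yes _ | true = refl
  ... | no _ | yes _ | false = refl
  ... | no _ | no _ | true = refl
  ... | no _ | no _ | false = refl
  ... | yes refl | yes refl | true with trans (sym ij) (irrefl G i)
  ...   | ()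

  -- Summed over ordered pairs, the removed edges are the pairs (v , j) and
  -- (i , v) with j, i neighbours of v.
  removed-total : ∑[ i < n ] ∑[ j < n ] 𝟙 (removed i j) ≡ deg G v + deg G v
  removed-total = begin
    ∑[ i < n ] ∑[ j < n ] 𝟙 (removed i j)
      ≡⟨ sum-cong-≗ (λ i → trans (sum-cong-≗ (removed-at-v i)) (∑-distrib-+ (row i) (column i))) ⟩
    ∑[ i < n ] (∑[ j < n ] row i j + ∑[ j < n ] column i j)
      ≡⟨ ∑-distrib-+ (λ i → ∑[ j < n ] row i j) (λ i → ∑[ j < n ] column i j) ⟩
    ∑[ i < n ] ∑[ j < n ] row i j + ∑[ i < n ] ∑[ j < n ] column i j
      ≡⟨ cong₂ _+_ (trans (sum-cong-≗ row-sum) (∑-δ v (λ i → ∑[ j < n ] 𝟙 (adj G i j))))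
                   (sum-cong-≗ (λ i → ∑-δ v (λ j → 𝟙 (adj G i j)))) ⟩
    ∑[ j < n ] 𝟙 (adj G v j) + ∑[ i < n ] 𝟙 (adj G i v)
      ≡⟨ cong₂ _+_ (sym (deg-sum G v))
                   (trans (sum-cong-≗ (λ i → cong 𝟙 (Graph.sym G i v))) (sym (deg-sum G v))) ⟩
    deg G v + deg G v ∎
    where
    open ≡-Reasoning
    row column : Fin n → Fin n → ℕ
    row i j = at-v i (𝟙 (adj G i j))
    column i j = at-v j (𝟙 (adj G i j))
    row-sum : ∀ i → ∑[ j < n ] row i j ≡ at-v i (∑[ j < n ] 𝟙 (adj G i j))
    row-sum i with does (i ≟F v)
    ... | true = refl
    ... | false = ∑-zero n

  isolate-deleted : deleted G (isolate G v) ≡ deg G v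
  isolate-deleted = *-cancelˡ-≡ _ _ 2 (begin
    2 * deleted G (isolate G v)            ≡⟨ cong (2 *_) (deleted-edges G (isolate G v)) ⟩
    2 * edges removed                      ≡⟨ cong (edges removed +_) (+-identityʳ _) ⟩
    edges removed + edges removed          ≡⟨ handshake removed removed-sym removed-irr ⟨
    ∑[ i < n ] ∑[ j < n ] 𝟙 (removed i j)  ≡⟨ removed-total ⟩
    deg G v + deg G v                      ≡⟨ cong (deg G v +_) (+-identityʳ _) ⟨
    2 * deg G v                            ∎)
    where
    open ≡-Reasoning
    removed-sym : ∀ i j → removed i j ≡ removed j i
    removed-sym i j = cong₂ (λ a b → a ∧ not b) (Graph.sym G i j) (Graph.sym (isolate G v) i j)
    removed-irr : ∀ i → removed i i ≡ false
    removed-irr i = cong (λ b → b ∧ not (adj (isolate G v) i i)) (irrefl G i)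

involution⇒perfect : ∀ {n} (H : Graph n) (p : Fin n → Fin n) → (∀ x → p (p x) ≡ x) → (∀ x → p x ≢ x) →
  (∀ u → adj H u (p u) ≡ true) → HasPerfectMatching H
involution⇒perfect {n} H p p-inv p-≢ pairs-in-H =
  M , M⊆H , λ u → trans (deg-sum M u) (∑-δ (p u) (λ _ → 1))
  where
  pairs-sym : ∀ u w → does (w ≟F p u) ≡ does (u ≟F p w)
  pairs-sym u w with w ≟F p u | u ≟F p w
  ... | yes _ | yes _ = refl
  ... | no _ | no _ = refl
  ... | yes refl | no u≢ppu = ⊥-elim (u≢ppu (sym (p-inv u)))
  ... | no w≢pu | yes refl = ⊥-elim (w≢pu (sym (p-inv w)))
  M : Graph n
  M = record
    { adj = λ u w → does (w ≟F p u)
    ; sym = pairs-sym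
    ; irrefl = λ u → dec-false (u ≟F p u) (λ u≡pu → p-≢ u (sym u≡pu))
    }
  M⊆H : M ⊆G H
  M⊆H u w paired with w ≟F p u
  ... | yes refl = pairs-in-H u

-- A 1-factorisation of the complete graph on Fin n with colours Fin m: for
-- every colour c a fixed-point-free involution partner c (a perfect matching
-- of the complete graph) such that every edge {x , partner c x} has colour c.
-- In particular distinct colour classes share no edge.
record Factorisation (n m : ℕ) : Set where
  field
    partner            : Fin m → Fin n → Fin n
    partner-involutive : ∀ c x → partner c (partner c x) ≡ x
    partner-≢          : ∀ c x → partner c x ≢ x
    colour             : Fin n → Fin n → Fin m
    colour-partner     : ∀ c x → colour x (partner c x) ≡ c

conj : ∀ {n} → Permutation′ n → (Fin n → Fin n) → Fin n → Fin n
conj π p x = π ⟨$⟩ʳ p (π ⟨$⟩ˡ x)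

module _ {n : ℕ} (π : Permutation′ n) (p : Fin n → Fin n) where

  conj-involutive : (∀ x → p (p x) ≡ x) → ∀ x → conj π p (conj π p x) ≡ x
  conj-involutive p-inv x = begin
    π ⟨$⟩ʳ p (π ⟨$⟩ˡ (π ⟨$⟩ʳ p (π ⟨$⟩ˡ x)))  ≡⟨ cong (λ y → π ⟨$⟩ʳ p y) (inverseˡ π) ⟩
    π ⟨$⟩ʳ p (p (π ⟨$⟩ˡ x))                  ≡⟨ cong (π ⟨$⟩ʳ_) (p-inv _) ⟩
    π ⟨$⟩ʳ (π ⟨$⟩ˡ x)                        ≡⟨ inverseʳ π ⟩
    x                                         ∎
    where open ≡-Reasoning

  conj-≢ : (∀ x → p x ≢ x) → ∀ x → conj π p x ≢ x
  conj-≢ p-≢ x fixed = p-≢ (π ⟨$⟩ˡ x) (trans (sym (inverseˡ π)) (cong (π ⟨$⟩ˡ_) fixed))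

relabel : ∀ {n m} → Permutation′ n → Factorisation n m → Factorisation n m
relabel π F = record
  { partner            = λ c → conj π (partner c)
  ; partner-involutive = λ c → conj-involutive π (partner c) (partner-involutive c)
  ; partner-≢          = λ c → conj-≢ π (partner c) (partner-≢ c)
  ; colour             = λ x y → colour (π ⟨$⟩ˡ x) (π ⟨$⟩ˡ y)
  ; colour-partner     = λ c x → trans (cong (colour (π ⟨$⟩ˡ x)) (inverseˡ π)) (colour-partner c _)
  }
  where open Factorisation F

missing : ∀ m (xs : List (Fin m)) → length xs < m → ∃ λ c → c ∉ xs
missing m xs xs<m = ¬∀⟶∃¬ m (_∈ xs) (_∈? xs) covers-all
  where
  open import Data.List.Membership.DecPropositional (_≟F_ {m}) using (_∈?_)
  covers-all : ¬ (∀ c → c ∈ xs)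
  covers-all all∈ with pigeonhole xs<m (λ c → index (all∈ c))
  ... | i , j , i<j , same-index =
    <-irrefl (cong toℕ (trans (lookup-index (all∈ i))
                        (trans (cong (lookup xs) same-index) (sym (lookup-index (all∈ j)))))) i<j

selected : ∀ {A : Set} → Bool → A → List A
selected true x = x ∷ []
selected false x = []

length-selected : ∀ {A B : Set} (xs : List A) (b : A → Bool) (f : A → B) →
  length (concatMap (λ x → selected (b x) (f x)) xs) ≡ countT (map b xs)
length-selected [] b f = refl
length-selected (x ∷ xs) b f with b x
... | true = cong suc (length-selected xs b f)
... | false = length-selected xs b f

length-concatMap : ∀ {A B : Set} (K : A → List B) (C : A → List Bool) →
  (∀ x → length (K x) ≡ countT (C x)) → ∀ xs → length (concatMap K xs) ≡ countT (concatMap C xs)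
length-concatMap K C same [] = refl
length-concatMap K C same (x ∷ xs) =
  trans (length-++ (K x)) (trans (cong₂ _+_ (same x) (length-concatMap K C same xs)) (sym (countT-++ (C x) _)))

module _ {n m : ℕ} (F : Factorisation n m) (G H : Graph n) where

  open Factorisation F

  lostColours : List (Fin m)
  lostColours =
    concatMap (λ i → concatMap (λ j → selected (lost G H i j) (colour i j)) (allFin n)) (allFin n)

  length-lostColours : length lostColours ≡ deleted G H
  length-lostColours =
    length-concatMap _ (λ i → map (lost G H i) (allFin n))
                     (λ i → length-selected (allFin n) (lost G H i) (colour i)) (allFin n)

  length-with-lost : ∀ xs → length (xs ++ lostColours) ≡ length xs + deleted G H
  length-with-lost xs = trans (length-++ xs) (cong (length xs +_) length-lostColours)

  lostColour-∈ : ∀ i j → lost G H i j ≡ true → colour i j ∈ lostColours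
  lostColour-∈ i j lost-ij =
    ∈-concatMap⁺ _ (lose (∈-allFin i) (∈-concatMap⁺ _ (lose (∈-allFin j) listed)))
    where
    listed : colour i j ∈ selected (lost G H i j) (colour i j)
    listed rewrite lost-ij = here refl

  deleted-edge-colour : ∀ c u → adj G u (partner c u) ≡ true → adj H u (partner c u) ≡ false →
    c ∈ lostColours
  deleted-edge-colour c u in-G not-in-H with <-cmp (toℕ u) (toℕ (partner c u))
  ... | tri< u<w _ _ = subst (_∈ lostColours) (colour-partner c u) (lostColour-∈ u w lost-uw)
    where
    w : Fin n
    w = partner c u
    lost-uw : lost G H u w ≡ true
    lost-uw rewrite <ᵇ-true u<w | in-G | not-in-H = refl
  ... | tri≈ _ u≡w _ = ⊥-elim (partner-≢ c u (sym (toℕ-injective u≡w)))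
  ... | tri> _ _ w<u = subst (_∈ lostColours) colour-wu (lostColour-∈ w u lost-wu)
    where
    w : Fin n
    w = partner c u
    colour-wu : colour w u ≡ c
    colour-wu = trans (cong (colour w) (sym (partner-involutive c u))) (colour-partner c w)
    lost-wu : lost G H w u ≡ true
    lost-wu rewrite <ᵇ-true w<u | Graph.sym G w u | Graph.sym H w u | in-G | not-in-H = refl

  -- Robustness of a 1-factorisation: if xs lists every colour whose class
  -- contains a non-edge of G, and length xs + deleted G H < m, then some
  -- colour class avoids both, so it is a perfect matching of H.
  robust : (xs : List (Fin m)) → (∀ c u → adj G u (partner c u) ≡ false → c ∈ xs) →
    length xs + deleted G H < m → HasPerfectMatching H
  robust xs non-edges-listed few
    with missing m (xs ++ lostColours) (subst (_< m) (sym (length-with-lost xs)) few)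
  ... | c , c-unlisted = involution⇒perfect H (partner c) (partner-involutive c) (partner-≢ c) in-H
    where
    in-H : ∀ u → adj H u (partner c u) ≡ true
    in-H u with adj H u (partner c u) in not-in-H
    ... | true = refl
    ... | false with adj G u (partner c u) in in-G
    ...   | false = ⊥-elim (c-unlisted (∈-++⁺ˡ (non-edges-listed c u in-G)))
    ...   | true = ⊥-elim (c-unlisted (∈-++⁺ʳ xs (deleted-edge-colour c u in-G not-in-H)))

module Congruence (N : ℕ) .{{_ : NonZero N}} where

  infix 4 _≈_
  _≈_ : ℕ → ℕ → Set
  x ≈ y = x % N ≡ y % N

  ≈-+ : ∀ {a b c d} → a ≈ b → c ≈ d → a + c ≈ b + d
  ≈-+ {a} {b} {c} {d} a≈b c≈d = begin
    (a + c) % N           ≡⟨ %-distribˡ-+ a c N ⟩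
    (a % N + c % N) % N   ≡⟨ cong₂ (λ x y → (x + y) % N) a≈b c≈d ⟩
    (b % N + d % N) % N   ≡⟨ %-distribˡ-+ b d N ⟨
    (b + d) % N           ∎
    where open ≡-Reasoning

  ≈-*ˡ : ∀ c {a b} → a ≈ b → c * a ≈ c * b
  ≈-*ˡ c {a} {b} a≈b = begin
    (c * a) % N           ≡⟨ %-distribˡ-* c a N ⟩
    (c % N * (a % N)) % N ≡⟨ cong (λ x → (c % N * x) % N) a≈b ⟩
    (c % N * (b % N)) % N ≡⟨ %-distribˡ-* c b N ⟨
    (c * b) % N           ∎
    where open ≡-Reasoning

  reduce : ∀ x → x % N ≈ x
  reduce x = m%n%n≡m%n x N

  multiple : ∀ x m → x + m * N ≈ x
  multiple x m = [m+kn]%n≡m%n x m N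

  ≈⇒≡ : ∀ {x y} → x < N → y < N → x ≈ y → x ≡ y
  ≈⇒≡ x<N y<N x≈y = trans (sym (m<n⇒m%n≡m x<N)) (trans x≈y (m<n⇒m%n≡m y<N))

  neg : ℕ → ℕ
  neg a = N ∸ a % N

  neg-+ : ∀ a → neg a + a ≈ 0
  neg-+ a = begin
    (neg a + a) % N       ≡⟨ ≈-+ {neg a} refl (sym (reduce a)) ⟩
    (neg a + a % N) % N   ≡⟨ cong (_% N) (m∸n+n≡m (<⇒≤ (m%n<n a N))) ⟩
    N % N                 ≡⟨ n%n≡0 N ⟩
    0                     ≡⟨ m<n⇒m%n≡m (>-nonZero⁻¹ N) ⟨
    0 % N                 ∎
    where open ≡-Reasoning

  cancelˡ : ∀ a {b c} → a + b ≈ a + c → b ≈ c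
  cancelˡ a {b} {c} a+b≈a+c = begin
    b % N                     ≡⟨ ≈-+ (neg-+ a) (refl {x = b % N}) ⟨
    (neg a + a + b) % N       ≡⟨ cong (_% N) (+-assoc (neg a) a b) ⟩
    (neg a + (a + b)) % N     ≡⟨ ≈-+ {neg a} refl a+b≈a+c ⟩
    (neg a + (a + c)) % N     ≡⟨ cong (_% N) (+-assoc (neg a) a c) ⟨
    (neg a + a + c) % N       ≡⟨ ≈-+ (neg-+ a) refl ⟩
    c % N                     ∎
    where open ≡-Reasoning

  solve : ∀ a k → ∃ λ b → b < N × a + b ≈ k
  solve a k = (neg a + k) % N , m%n<n _ N , (begin
    (a + (neg a + k) % N) % N  ≡⟨ ≈-+ {a} refl (reduce (neg a + k)) ⟩
    (a + (neg a + k)) % N      ≡⟨ cong (_% N) (trans (sym (+-assoc a (neg a) k)) (cong (_+ k) (+-comm a (neg a)))) ⟩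
    (neg a + a + k) % N        ≡⟨ ≈-+ (neg-+ a) refl ⟩
    k % N                      ∎)
    where open ≡-Reasoning

-- Modulo an odd number N = 2t + 1 the number t + 1 is an inverse of 2, so
-- doubling is a bijection on residues.
module OddCongruence (N t : ℕ) .{{_ : NonZero N}} (N-odd : N ≡ suc (2 * t)) where

  open Congruence N public

  halve-double : ∀ x → suc t * (x + x) ≈ x
  halve-double x = trans (cong (_% N) (inverse-of-2 x)) (multiple x x)
    where
    inverse-of-2 : ∀ x → suc t * (x + x) ≡ x + x * N
    inverse-of-2 x rewrite N-odd = identity x t
      where
      identity : ∀ x t → suc t * (x + x) ≡ x + x * suc (2 * t)
      identity = solve-∀

  double-injective : ∀ {x y} → x < N → y < N → x + x ≈ y + y → x ≡ y
  double-injective {x} {y} x<N y<N 2x≈2y = ≈⇒≡ x<N y<N (begin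
    x % N                 ≡⟨ halve-double x ⟨
    (suc t * (x + x)) % N ≡⟨ ≈-*ˡ (suc t) 2x≈2y ⟩
    (suc t * (y + y)) % N ≡⟨ halve-double y ⟩
    y % N                 ∎)
    where open ≡-Reasoning

  half : ∀ k → ∃ λ h → h < N × h + h ≈ k
  half k = h , m%n<n _ N , (begin
    (h + h) % N                        ≡⟨ ≈-+ (reduce (suc t * k)) (reduce (suc t * k)) ⟩
    (suc t * k + suc t * k) % N        ≡⟨ cong (_% N) (*-distribˡ-+ (suc t) k k) ⟨
    (suc t * (k + k)) % N              ≡⟨ halve-double k ⟩
    k % N                              ∎)
    where
    open ≡-Reasoning
    h : ℕ
    h = (suc t * k) % N


-- The round-robin colouring of the complete graph on the vertices
-- 0 , … , N, with N odd and the vertex N playing the role of ∞, by the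
-- colours 0 , … , N - 1: finite a ≠ b get colour a + b, and {∞ , b} gets
-- colour 2b (mod N).
module RoundRobin (N t : ℕ) .{{_ : NonZero N}} (N-odd : N ≡ suc (2 * t)) where

  open OddCongruence N t N-odd

  Matched : ℕ → ℕ → ℕ → Set
  Matched k a b = (a ≡ N × b < N × b + b ≈ k)
                ⊎ (b ≡ N × a < N × a + a ≈ k)
                ⊎ (a < N × b < N × a ≢ b × a + b ≈ k)

  matched? : ∀ k a b → Dec (Matched k a b)
  matched? k a b =
    ((a ≟ N) ×-dec (b <? N) ×-dec ((b + b) % N ≟ k % N))
    ⊎-dec ((b ≟ N) ×-dec (a <? N) ×-dec ((a + a) % N ≟ k % N))
    ⊎-dec ((a <? N) ×-dec (b <? N) ×-dec ¬? (a ≟ b) ×-dec ((a + b) % N ≟ k % N))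

  matched-sym : ∀ {k a b} → Matched k a b → Matched k b a
  matched-sym (inj₁ ∞-b) = inj₂ (inj₁ ∞-b)
  matched-sym (inj₂ (inj₁ a-∞)) = inj₁ a-∞
  matched-sym {k} {a} {b} (inj₂ (inj₂ (a<N , b<N , a≢b , a+b≈k))) =
    inj₂ (inj₂ (b<N , a<N , ≢-sym a≢b , trans (cong (_% N) (+-comm b a)) a+b≈k))

  private
    ∞≮N : ∀ {a} → a ≡ N → a < N → ⊥
    ∞≮N refl = <-irrefl refl

  matched-irrefl : ∀ {k a} → ¬ Matched k a a
  matched-irrefl (inj₁ (a≡N , a<N , _)) = ∞≮N a≡N a<N
  matched-irrefl (inj₂ (inj₁ (a≡N , a<N , _))) = ∞≮N a≡N a<N
  matched-irrefl (inj₂ (inj₂ (_ , _ , a≢a , _))) = a≢a refl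

  matched-colour : ∀ {k k′ a b} → Matched k a b → Matched k′ a b → k ≈ k′
  matched-colour (inj₁ (_ , _ , e)) (inj₁ (_ , _ , e′)) = trans (sym e) e′
  matched-colour (inj₁ (a≡N , _)) (inj₂ (inj₁ (_ , a<N , _))) = ⊥-elim (∞≮N a≡N a<N)
  matched-colour (inj₁ (a≡N , _)) (inj₂ (inj₂ (a<N , _))) = ⊥-elim (∞≮N a≡N a<N)
  matched-colour (inj₂ (inj₁ (_ , a<N , _))) (inj₁ (a≡N , _)) = ⊥-elim (∞≮N a≡N a<N)
  matched-colour (inj₂ (inj₁ (_ , _ , e))) (inj₂ (inj₁ (_ , _ , e′))) = trans (sym e) e′
  matched-colour (inj₂ (inj₁ (b≡N , _))) (inj₂ (inj₂ (_ , b<N , _))) = ⊥-elim (∞≮N b≡N b<N)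
  matched-colour (inj₂ (inj₂ (a<N , _))) (inj₁ (a≡N , _)) = ⊥-elim (∞≮N a≡N a<N)
  matched-colour (inj₂ (inj₂ (_ , b<N , _))) (inj₂ (inj₁ (b≡N , _))) = ⊥-elim (∞≮N b≡N b<N)
  matched-colour (inj₂ (inj₂ (_ , _ , _ , e))) (inj₂ (inj₂ (_ , _ , _ , e′))) = trans (sym e) e′

  matched-functional : ∀ {k a b b′} → Matched k a b → Matched k a b′ → b ≡ b′
  matched-functional (inj₁ (_ , b<N , e)) (inj₁ (_ , b′<N , e′)) =
    double-injective b<N b′<N (trans e (sym e′))
  matched-functional (inj₁ (a≡N , _)) (inj₂ (inj₁ (_ , a<N , _))) = ⊥-elim (∞≮N a≡N a<N)
  matched-functional (inj₁ (a≡N , _)) (inj₂ (inj₂ (a<N , _))) = ⊥-elim (∞≮N a≡N a<N)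
  matched-functional (inj₂ (inj₁ (_ , a<N , _))) (inj₁ (a≡N , _)) = ⊥-elim (∞≮N a≡N a<N)
  matched-functional (inj₂ (inj₁ (b≡N , _))) (inj₂ (inj₁ (b′≡N , _))) = trans b≡N (sym b′≡N)
  matched-functional {a = a} (inj₂ (inj₁ (_ , a<N , e))) (inj₂ (inj₂ (_ , b′<N , a≢b′ , e′))) =
    ⊥-elim (a≢b′ (≈⇒≡ a<N b′<N (cancelˡ a (trans e (sym e′)))))
  matched-functional (inj₂ (inj₂ (a<N , _))) (inj₁ (a≡N , _)) = ⊥-elim (∞≮N a≡N a<N)
  matched-functional {a = a} (inj₂ (inj₂ (_ , b<N , a≢b , e))) (inj₂ (inj₁ (_ , a<N , e′))) =
    ⊥-elim (a≢b (≈⇒≡ a<N b<N (cancelˡ a (trans e′ (sym e)))))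
  matched-functional {a = a} (inj₂ (inj₂ (_ , b<N , _ , e))) (inj₂ (inj₂ (_ , b′<N , _ , e′))) =
    ≈⇒≡ b<N b′<N (cancelˡ a (trans e (sym e′)))

  matched-total : ∀ k a → a ≤ N → ∃ λ b → b ≤ N × Matched k a b
  matched-total k a a≤N with m≤n⇒m<n∨m≡n a≤N
  ... | inj₂ a≡N with half k
  ...   | h , h<N , 2h≈k = h , <⇒≤ h<N , inj₁ (a≡N , h<N , 2h≈k)
  matched-total k a a≤N | inj₁ a<N with (a + a) % N ≟ k % N
  ... | yes 2a≈k = N , ≤-refl , inj₂ (inj₁ (refl , a<N , 2a≈k))
  ... | no 2a≉k with solve a k
  ...   | b , b<N , a+b≈k =
          b , <⇒≤ b<N , inj₂ (inj₂ (a<N , b<N , (λ { refl → 2a≉k a+b≈k }) , a+b≈k))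

  partnerOf : (c : Fin N) (x : Fin (suc N)) → ∃ λ y → Matched (toℕ c) (toℕ x) (toℕ y)
  partnerOf c x with matched-total (toℕ c) (toℕ x) (≤-pred (toℕ<n x))
  ... | b , b≤N , matched = fromℕ< (s≤s b≤N) , subst (Matched _ _) (sym (toℕ-fromℕ< _)) matched

  -- the colour of an edge {x , y}: the colour class containing it, found
  -- by search (an arbitrary colour when x ≡ y)
  HasColour : Fin (suc N) → Fin (suc N) → Set
  HasColour x y = ∃ λ (c : Fin N) → Matched (toℕ c) (toℕ x) (toℕ y)

  chosenColour : ∀ {x y} → Dec (HasColour x y) → Fin N
  chosenColour (yes (c , _)) = c
  chosenColour (no _) = fromℕ< (>-nonZero⁻¹ N)

  colourOf : Fin (suc N) → Fin (suc N) → Fin N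
  colourOf x y = chosenColour (any? (λ c → matched? (toℕ c) (toℕ x) (toℕ y)))

  chosenColour-matched : ∀ {c x y} (found : Dec (HasColour x y)) →
    Matched (toℕ c) (toℕ x) (toℕ y) → chosenColour found ≡ c
  chosenColour-matched {c} (yes (c′ , matched′)) matched =
    toℕ-injective (≈⇒≡ (toℕ<n c′) (toℕ<n c) (matched-colour matched′ matched))
  chosenColour-matched {c} (no unmatched) matched = ⊥-elim (unmatched (c , matched))

  colourOf-matched : ∀ {c x y} → Matched (toℕ c) (toℕ x) (toℕ y) → colourOf x y ≡ c
  colourOf-matched {x = x} {y} = chosenColour-matched (any? (λ c → matched? (toℕ c) (toℕ x) (toℕ y)))

  roundRobin : Factorisation (suc N) N
  roundRobin = record
    { partner            = partner
    ; partner-involutive = λ c x →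
        toℕ-injective (matched-functional (matched c (partner c x)) (matched-sym (matched c x)))
    ; partner-≢          = λ c x y≡x →
        matched-irrefl (subst (λ y → Matched (toℕ c) (toℕ x) (toℕ y)) y≡x (matched c x))
    ; colour             = colourOf
    ; colour-partner     = λ c x → colourOf-matched (matched c x)
    }
    where
    partner : Fin N → Fin (suc N) → Fin (suc N)
    partner c x = proj₁ (partnerOf c x)
    matched : ∀ c x → Matched (toℕ c) (toℕ x) (toℕ (partner c x))
    matched c x = proj₂ (partnerOf c x)

module _ {n : ℕ} (i j : Fin n) where

  transpose-at-j : PC.transpose i j j ≡ i
  transpose-at-j with j ≟F i
  ... | yes refl = refl
  ... | no _ rewrite dec-true (j ≟F j) refl = refl

  transpose-elsewhere : ∀ {k} → k ≢ i → k ≢ j → PC.transpose i j k ≡ k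
  transpose-elsewhere {k} k≢i k≢j rewrite dec-false (k ≟F i) k≢i | dec-false (k ≟F j) k≢j = refl

-- the complement of G is a matching: every vertex has at most one
-- non-neighbour other than itself
CoMatching : ∀ {n} → Graph n → Set
CoMatching G = ∀ v a b → a ≢ v → b ≢ v → adj G v a ≡ false → adj G v b ≡ false → a ≡ b

-- Alignment: if the complement of G is a matching, then some conjugate of any
-- given fixed-point-free involution q pairs every vertex with its
-- non-neighbour, if it has one.  The conjugating permutation is built vertex by
-- vertex, correcting the current conjugate p at the vertex v by a further
-- conjugation with the transposition of v's non-neighbour w and p v.
module Alignment {n : ℕ} (G : Graph n) (co-matching : CoMatching G) (q : Fin n → Fin n)
                 (q-inv : ∀ x → q (q x) ≡ x) (q-≢ : ∀ x → q x ≢ x) where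

  Respects : (Fin n → Fin n) → Fin n → Set
  Respects p u = ∀ w → u ≢ w → adj G u w ≡ false → p u ≡ w

  respects-non-neighbour : ∀ {p u w} → p u ≡ w → u ≢ w → adj G u w ≡ false → Respects p u
  respects-non-neighbour pu≡w u≢w u≁w w′ u≢w′ u≁w′ =
    trans pu≡w (co-matching _ _ w′ (≢-sym u≢w) (≢-sym u≢w′) u≁w u≁w′)

  module Swap (π : Permutation′ n) (v w : Fin n) (v≢w : v ≢ w) (v≁w : adj G v w ≡ false)
              (pv≢w : conj π q v ≢ w) where

    p : Fin n → Fin n
    p = conj π q
    x : Fin n
    x = p v
    π′ : Permutation′ n
    π′ = π ∘ₚ transpose w x
    p′ : Fin n → Fin n
    p′ = conj π′ q

    p-inv : ∀ y → p (p y) ≡ y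
    p-inv = conj-involutive π q q-inv

    v≢x : v ≢ x
    v≢x v≡x = conj-≢ π q q-≢ v (sym v≡x)

    swap-sends-v : p′ v ≡ w
    swap-sends-v = begin
      PC.transpose w x (p (PC.transpose x w v)) ≡⟨ cong (PC.transpose w x ∘ p) (transpose-elsewhere x w v≢x v≢w) ⟩
      PC.transpose w x x                        ≡⟨ transpose-at-j w x ⟩
      w                                         ∎
      where open ≡-Reasoning

    -- w is the non-neighbour of v, so p cannot already pair w correctly
    ¬respects-w : ¬ Respects p w
    ¬respects-w respects = pv≢w (trans (cong p (sym pw≡v)) (p-inv w))
      where
      pw≡v : p w ≡ v
      pw≡v = respects v (≢-sym v≢w) (trans (Graph.sym G w v) v≁w)

    -- x = p v is paired with v, which is a non-neighbour of x only if v
    -- has the two non-neighbours w and x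
    ¬respects-x : ∀ w′ → x ≢ w′ → adj G x w′ ≡ false → p x ≡ w′ → ⊥
    ¬respects-x w′ x≢w′ x≁w′ px≡w′ = pv≢w (sym (co-matching v w x (≢-sym v≢w) (≢-sym v≢x) v≁w v≁x))
      where
      w′≡v : w′ ≡ v
      w′≡v = trans (sym px≡w′) (p-inv v)
      v≁x : adj G v x ≡ false
      v≁x = trans (Graph.sym G v x) (subst (λ y → adj G x y ≡ false) w′≡v x≁w′)

    keeps-elsewhere : ∀ u w′ → u ≢ v → u ≢ w → u ≢ x → u ≢ w′ → adj G u w′ ≡ false → p u ≡ w′ →
      p′ u ≡ w′
    keeps-elsewhere u w′ u≢v u≢w u≢x u≢w′ u≁w′ pu≡w′ = begin
      PC.transpose w x (p (PC.transpose x w u)) ≡⟨ cong (PC.transpose w x ∘ p) (transpose-elsewhere x w u≢x u≢w) ⟩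
      PC.transpose w x (p u)                    ≡⟨ cong (PC.transpose w x) pu≡w′ ⟩
      PC.transpose w x w′                       ≡⟨ transpose-elsewhere w x w′≢w w′≢x ⟩
      w′                                        ∎
      where
      open ≡-Reasoning
      -- otherwise w would have the two non-neighbours u and v
      w′≢w : w′ ≢ w
      w′≢w refl =
        u≢v (co-matching w u v u≢w v≢w (trans (Graph.sym G w u) u≁w′) (trans (Graph.sym G w v) v≁w))
      -- otherwise p u ≡ p v
      w′≢x : w′ ≢ x
      w′≢x w′≡x = u≢v (trans (sym (p-inv u)) (trans (cong p (trans pu≡w′ w′≡x)) (p-inv v)))

    swap-keeps : ∀ u → u ≢ v → Respects p u → Respects p′ u
    swap-keeps u u≢v respects w′ u≢w′ u≁w′ = by-cases (u ≟F w) (u ≟F x)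
      where
      by-cases : Dec (u ≡ w) → Dec (u ≡ x) → p′ u ≡ w′
      by-cases (yes u≡w) _ = ⊥-elim (¬respects-w (subst (Respects p) u≡w respects))
      by-cases _ (yes u≡x) = ⊥-elim (¬respects-x w′ (subst (_≢ w′) u≡x u≢w′)
                                       (subst (λ y → adj G y w′ ≡ false) u≡x u≁w′)
                                       (subst (λ y → p y ≡ w′) u≡x (respects w′ u≢w′ u≁w′)))
      by-cases (no u≢w) (no u≢x) =
        keeps-elsewhere u w′ u≢v u≢w u≢x u≢w′ u≁w′ (respects w′ u≢w′ u≁w′)

  fix-vertex : (π : Permutation′ n) (v : Fin n) → Σ (Permutation′ n) λ π′ →
    Respects (conj π′ q) v × (∀ u → u ≢ v → Respects (conj π q) u → Respects (conj π′ q) u)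
  fix-vertex π v with any? (λ w → ¬? (v ≟F w) ×-dec (adj G v w ≟B false))
  ... | no no-non-neighbour =
    π , (λ w v≢w v≁w → ⊥-elim (no-non-neighbour (w , v≢w , v≁w))) , (λ _ _ r → r)
  ... | yes (w , v≢w , v≁w) with conj π q v ≟F w
  ...   | yes pv≡w = π , respects-non-neighbour {conj π q} pv≡w v≢w v≁w , (λ _ _ r → r)
  ...   | no pv≢w = π′ , respects-non-neighbour {p′} swap-sends-v v≢w v≁w , swap-keeps
    where open Swap π v w v≢w v≁w pv≢w

  align-below : ∀ k → k ≤ n → Σ (Permutation′ n) λ π → ∀ u → toℕ u < k → Respects (conj π q) u
  align-below zero _ = idₚ , λ u ()
  align-below (suc k) k<n with align-below k (<⇒≤ k<n)
  ... | π , below-k with fix-vertex π (fromℕ< k<n)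
  ...   | π′ , at-k , keeps = π′ , below-1+k
    where
    below-1+k : ∀ u → toℕ u < suc k → Respects (conj π′ q) u
    below-1+k u u<1+k with m≤n⇒m<n∨m≡n (≤-pred u<1+k)
    ... | inj₁ u<k = keeps u (λ { refl → <-irrefl (toℕ-fromℕ< k<n) u<k }) (below-k u u<k)
    ... | inj₂ u≡k =
      subst (Respects (conj π′ q)) (toℕ-injective (trans (toℕ-fromℕ< k<n) (sym u≡k))) at-k

  align : Σ (Permutation′ n) λ π → ∀ u → Respects (conj π q) u
  align with align-below n ≤-refl
  ... | π , all-below = π , λ u → all-below u (toℕ<n u)

-- The graph G on n = 2t + 2 vertices; the threshold n - 2 of the theorem is 2t.
module Main (t : ℕ) (G : Graph (2 + 2 * t)) where

  n : ℕ
  n = 2 + 2 * t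

  F : Factorisation n (suc (2 * t))
  F = RoundRobin.roundRobin (suc (2 * t)) t refl

  open Factorisation

  HighMinDegree : Set
  HighMinDegree = ∀ v → 2 * t ≤ deg G v

  isolate-unmatchable : ∀ v → Unmatchable (isolate G v)
  isolate-unmatchable v =
    isolated⇒no-perfect (isolate G v) v (isolate-isolates G v) , no-almost-perfect t (isolate G v)

  -- δ(G) ≥ n - 2: three distinct vertices v, a, b with a, b non-neighbours of v
  -- would force deg G v ≤ n - 3
  co-matching : HighMinDegree → CoMatching G
  co-matching low v a b a≢v b≢v v≁a v≁b with a ≟F b
  ... | yes a≡b = a≡b
  ... | no a≢b = ⊥-elim (1+n≰n (subst (_≤ n) (+-comm (2 * t) 3) (≤-trans (+-monoˡ-≤ 3 (low v)) bound)))
    where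
    bound : deg G v + 3 ≤ n
    bound = nonNeighbours-bound G v (v ∷ a ∷ b ∷ [])
              ((≢-sym a≢v ∷ ≢-sym b≢v ∷ []) ∷ (a≢b ∷ []) ∷ [] ∷ []) (irrefl G v ∷ v≁a ∷ v≁b ∷ [])

  -- δ(G) ≥ n - 2 and no vertex of degree n - 2: a non-neighbour w of u would
  -- force deg G u ≤ n - 2, so G is complete
  complete : HighMinDegree → (∀ v → deg G v ≢ 2 * t) → ∀ u w → u ≢ w → adj G u w ≡ true
  complete low not-attained u w u≢w with adj G u w in u≁w
  ... | true = refl
  ... | false = ⊥-elim (not-attained u (≤-antisym (+-cancelʳ-≤ 2 _ _ bound) (low u)))
    where
    bound : deg G u + 2 ≤ 2 * t + 2
    bound = subst (deg G u + 2 ≤_) (+-comm 2 (2 * t))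
               (nonNeighbours-bound G u (u ∷ w ∷ []) ((u≢w ∷ []) ∷ [] ∷ []) (irrefl G u ∷ u≁w ∷ []))

  -- If δ(G) ≥ n - 2, deleting fewer than n - 2 edges leaves a perfect matching:
  -- relabel the round-robin factorisation so that colour 0 pairs every vertex with
  -- its non-neighbour; then only colour 0 meets non-edges of G.
  few-deletions-perfect : HighMinDegree → (H : Graph n) → deleted G H < 2 * t → HasPerfectMatching H
  few-deletions-perfect low H few = robust F′ G H (zero ∷ []) only-colour-0 (s≤s few)
    where
    open Alignment G (co-matching low) (partner F zero) (partner-involutive F zero) (partner-≢ F zero)
    π : Permutation′ n
    π = proj₁ align
    F′ : Factorisation n (suc (2 * t))
    F′ = relabel π F
    only-colour-0 : ∀ c u → adj G u (partner F′ c u) ≡ false → c ∈ zero ∷ []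
    only-colour-0 c u u≁pu = here (begin
      c                                  ≡⟨ colour-partner F′ c u ⟨
      colour F′ u (partner F′ c u)       ≡⟨ cong (colour F′ u) same-partner ⟨
      colour F′ u (partner F′ zero u)    ≡⟨ colour-partner F′ zero u ⟩
      zero                               ∎)
      where
      open ≡-Reasoning
      same-partner : partner F′ zero u ≡ partner F′ c u
      same-partner = proj₂ align u (partner F′ c u) (≢-sym (partner-≢ F′ c u)) u≁pu

  complete-perfect : (∀ u w → u ≢ w → adj G u w ≡ true) → (H : Graph n) → deleted G H ≤ 2 * t →
    HasPerfectMatching H
  complete-perfect G-complete H at-most = robust F G H [] no-non-edges (s≤s at-most)
    where
    no-non-edges : ∀ c u → adj G u (partner F c u) ≡ false → c ∈ []
    no-non-edges c u u≁pu with trans (sym u≁pu) (G-complete u (partner F c u) (≢-sym (partner-≢ F c u)))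
    ... | ()

  mp⇒δ : IsMP G (2 * t) → IsMinDegree G (2 * t)
  mp⇒δ ((H , H⊆G , H-unmatchable , deleted≡) , minimal) = low , attained
    where
    low : HighMinDegree
    low v = subst (2 * t ≤_) (isolate-deleted G v) (minimal (isolate G v) (isolate-⊆ G v) (isolate-unmatchable v))
    attained : ∃ λ v → deg G v ≡ 2 * t
    attained with any? (λ v → deg G v ≟ 2 * t)
    ... | yes found = found
    ... | no none = ⊥-elim (proj₁ H-unmatchable
            (complete-perfect (complete low (λ v d≡ → none (v , d≡))) H (≤-reflexive deleted≡)))

  δ⇒mp : IsMinDegree G (2 * t) → IsMP G (2 * t)
  δ⇒mp (low , v , deg-v) =
    (isolate G v , isolate-⊆ G v , isolate-unmatchable v , trans (isolate-deleted G v) deg-v) , minimal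
    where
    minimal : ∀ H → H ⊆G G → Unmatchable H → 2 * t ≤ deleted G H
    minimal H _ H-unmatchable with deleted G H <? 2 * t
    ... | yes few = ⊥-elim (proj₁ H-unmatchable (few-deletions-perfect low H few))
    ... | no not-few = ≮⇒≥ not-few

even-form : ∀ n → 4 ≤ n → 2 ∣ n → ∃ λ t → n ≡ 2 + 2 * t
even-form n 4≤n (divides zero refl) with 4≤n
... | ()
even-form n 4≤n (divides (suc t) refl) = t , cong (2 +_) (*-comm t 2)

theorem3p5 : (n : ℕ) → 4 ≤ n → 2 ∣ n → (G : Graph n) →
    (IsMP G (n ∸ 2) → IsMinDegree G (n ∸ 2)) × (IsMinDegree G (n ∸ 2) → IsMP G (n ∸ 2))
theorem3p5 n 4≤n 2∣n G with even-form n 4≤n 2∣n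
... | t , refl = Main.mp⇒δ t G , Main.δ⇒mp t G
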